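{- For any $m<\omega$ there are at most finitely many $\alpha<\varepsilon_0$ such that $A_\alpha(k,0)\leq m$.
   Context: Small Greek letters denote ordinals below $\varepsilon_0$; $k\geq 3$ is an integer. Standard fundamental sequences below $\varepsilon_0$: $0[x]:=0$, $(\alpha+1)[x]:=\alpha$, $\omega^{\alpha+1}(\beta+1)[x]:=\omega^{\alpha+1}\beta+\omega^\alpha\cdot x$, and $\omega^{\lambda}(\beta+1)[x]:=\omega^\lambda\beta+\omega^{\lambda[x]}$ for limit $\lambda$ (applied to the last Cantor normal form summand). The extended Ackermann functions are defined by $A_0(k,b):=b+1$, $A_{\alpha+1}(k,0):=A_\alpha(k,\cdot)^k(0)$, $A_{\alpha+1}(k,b+1):=A_\alpha(k,\cdot)^k(A_{\alpha+1}(k,b))$, $A_\lambda(k,0):=A_{\lambda_{k,k,0}}(k,\cdot)^k(0)$, $A_\lambda(k,b+1):=A_{\lambda_{k,k,A_\lambda(k,b)}}(k,\cdot)^k(A_\lambda(k,b))$ for limit $\lambda$, where $\lambda_{0,k,b}:=\lambda[b]$ and $\lambda_{l+1,k,b}:=\lambda[A_{\lambda_{l,k,b}}(k,b)]$ (upper index = number of iterations). -}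

module Defs where

open import Data.Nat using (ℕ; zero; suc)
open import Data.Sum using (_⊎_)
open import Relation.Binary.PropositionalEquality using (_≡_)

-- Ordinals below ε₀ are exactly the terms in Cantor normal form (IsCNF),
-- written as a non-increasing sum of powers of ω (coefficients = repetition).
data OT : Set where
  𝟎     : OT
  ω^_+_ : OT → OT → OT

infixr 6 ω^_+_

-- Ordinal order (correct on Cantor normal forms).
data _<ₒ_ : OT → OT → Set where
  z<ω  : ∀ {a b} → 𝟎 <ₒ (ω^ a + b)
  exp< : ∀ {a b c d} → a <ₒ c → (ω^ a + b) <ₒ (ω^ c + d)
  tl<  : ∀ {a b d} → b <ₒ d → (ω^ a + b) <ₒ (ω^ a + d)

_≤ₒ_ : OT → OT → Set
a ≤ₒ b = a <ₒ b ⊎ a ≡ b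

data IsCNF : OT → Set where
  cnf0 : IsCNF 𝟎
  cnf1 : ∀ {a} → IsCNF a → IsCNF (ω^ a + 𝟎)
  cnf2 : ∀ {a c d} → IsCNF a → IsCNF (ω^ c + d) → c ≤ₒ a → IsCNF (ω^ a + (ω^ c + d))

data Kind : Set where
  isZero : Kind
  isSucc : OT → Kind
  isLim  : Kind

kind : OT → Kind
kindTail : OT → Kind → Kind

kind 𝟎 = isZero
kind (ω^ 𝟎 + 𝟎) = isSucc 𝟎
kind (ω^ (ω^ _ + _) + 𝟎) = isLim
kind (ω^ a + (ω^ c + d)) = kindTail a (kind (ω^ c + d))

kindTail a isZero = isLim      -- impossible case (nonzero tail)
kindTail a (isSucc b') = isSucc (ω^ a + b')
kindTail a isLim = isLim

copies : OT → ℕ → OT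
copies a zero = 𝟎
copies a (suc x) = ω^ a + copies a x

_[_] : OT → ℕ → OT
lastExp : Kind → OT → ℕ → OT   -- fundamental sequence of ω^a, given kind a

𝟎 [ x ] = 𝟎
(ω^ a + 𝟎) [ x ] = lastExp (kind a) a x
(ω^ a + (ω^ c + d)) [ x ] = ω^ a + ((ω^ c + d) [ x ])

lastExp isZero a x = 𝟎
lastExp (isSucc a') a x = copies a' x
lastExp isLim a x = ω^ (a [ x ]) + 𝟎

-- Graph of the extended Ackermann functions (k fixed):
--   Ack k α b n      :  A_α(k,b) = n
--   Iter k α j b n   :  A_α(k,·)^j(b) = n
--   Seq k λ l b μ    :  λ_{l,k,b} = μ
data Ack (k : ℕ) : OT → ℕ → ℕ → Set
data Iter (k : ℕ) (α : OT) : ℕ → ℕ → ℕ → Set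
data Seq (k : ℕ) (λ' : OT) : ℕ → ℕ → OT → Set

data Ack k where
  ack0   : ∀ {b} → Ack k 𝟎 b (suc b)
  ackS0  : ∀ {α α' n} → kind α ≡ isSucc α' → Iter k α' k 0 n → Ack k α 0 n
  ackSS  : ∀ {α α' b m n} → kind α ≡ isSucc α' →
           Ack k α b m → Iter k α' k m n → Ack k α (suc b) n
  ackL0  : ∀ {α μ n} → kind α ≡ isLim → Seq k α k 0 μ → Iter k μ k 0 n → Ack k α 0 n
  ackLS  : ∀ {α μ b m n} → kind α ≡ isLim →
           Ack k α b m → Seq k α k m μ → Iter k μ k m n → Ack k α (suc b) n

data Iter k α where
  it0 : ∀ {b} → Iter k α 0 b b
  itS : ∀ {j b m n} → Iter k α j b m → Ack k α m n → Iter k α (suc j) b n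

data Seq k λ' where
  sq0 : ∀ {b} → Seq k λ' 0 b (λ' [ b ])
  sqS : ∀ {l b μ c} → Seq k λ' l b μ → Ack k μ b c → Seq k λ' (suc l) b (λ' [ c ])

module Submission where

-- The proof uses the size of an ordinal term, the number of ω-nodes in it.
--   1. Size and the ordinal structure: a successor α = α' + 1 has size one
--      more than α', and a fundamental sequence loses at most one node:
--      size α ≤ 1 + size (α[x]) whenever x ≥ 1.
--   2. Growth of the Ackermann functions (for k ≥ 2): by simultaneous
--      induction on the graphs Ack / Iter / Seq, A_α(k,b) > size α + b.
--      The successor and limit cases at b = 0 use Step 1; the cases b + 1
--      only use that A_α(k,·) is inflationary.
--   3. Enumeration: the terms of size ≤ m form an explicit finite list.
-- Hence A_α(k,0) ≤ m forces size α < m, so α lies in that list.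

open import Defs
open import Data.Nat using (ℕ; _≤_)
open import Data.List using (List)
open import Data.List.Membership.Propositional using (_∈_)
open import Data.Product using (Σ)

open import Data.Nat using (zero; suc; _+_; _<_; z≤n; s≤s)
open import Data.Nat.Properties
open import Data.List using ([]; _∷_; cartesianProductWith)
open import Data.List.Relation.Unary.Any using (here; there)
open import Data.List.Membership.Propositional.Properties using (∈-cartesianProductWith⁺)
open import Data.Product using (_,_)
open import Data.Empty using (⊥; ⊥-elim)
open import Relation.Binary.PropositionalEquality using (_≡_; refl; sym; cong; trans)

size : OT → ℕ
size 𝟎 = 0
size (ω^ a + b) = suc (size a + size b)

kind-cons : ∀ a c d → kind (ω^ a + (ω^ c + d)) ≡ kindTail a (kind (ω^ c + d))
kind-cons 𝟎 c d = refl
kind-cons (ω^ _ + _) c d = refl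

kindTail≢isZero : ∀ a K → kindTail a K ≡ isZero → ⊥
kindTail≢isZero a isZero ()
kindTail≢isZero a (isSucc _) ()
kindTail≢isZero a isLim ()

kind≡isZero⇒𝟎 : ∀ α → kind α ≡ isZero → α ≡ 𝟎
kind≡isZero⇒𝟎 𝟎 _ = refl
kind≡isZero⇒𝟎 (ω^ 𝟎 + 𝟎) ()
kind≡isZero⇒𝟎 (ω^ (ω^ _ + _) + 𝟎) ()
kind≡isZero⇒𝟎 (ω^ a + (ω^ c + d)) eq rewrite kind-cons a c d =
  ⊥-elim (kindTail≢isZero a (kind (ω^ c + d)) eq)

size-succ : ∀ α {α'} → kind α ≡ isSucc α' → size α ≡ suc (size α')
size-succ 𝟎 ()
size-succ (ω^ 𝟎 + 𝟎) refl = refl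
size-succ (ω^ (ω^ _ + _) + 𝟎) ()
size-succ (ω^ a + t@(ω^ c + d)) eq rewrite kind-cons a c d with kind t in kt
... | isSucc t' with refl ← eq =
  cong suc (trans (cong (size a +_) (size-succ t kt)) (+-suc (size a) (size t')))

copies-size : ∀ a x → suc (size a) ≤ size (copies a (suc x))
copies-size a x = s≤s (m≤m+n (size a) (size (copies a x)))

fund-size    : ∀ α x → size α ≤ suc (size (α [ suc x ]))
lastExp-size : ∀ a x → size a ≤ size (lastExp (kind a) a (suc x))

fund-size 𝟎 x = z≤n
fund-size (ω^ a + 𝟎) x =
  s≤s (≤-trans (≤-reflexive (+-identityʳ (size a))) (lastExp-size a x))
fund-size (ω^ a + t@(ω^ _ + _)) x =
  s≤s (≤-trans (+-monoʳ-≤ (size a) (fund-size t x)) (≤-reflexive (+-suc (size a) _)))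

lastExp-size a x with kind a in ka
... | isZero with refl ← kind≡isZero⇒𝟎 a ka = z≤n
... | isSucc a' = ≤-trans (≤-reflexive (size-succ a ka)) (copies-size a' x)
... | isLim = ≤-trans (fund-size a x) (s≤s (≤-reflexive (sym (+-identityʳ _))))

module Growth (i : ℕ) where

  k : ℕ
  k = 2 + i

  ack-bound         : ∀ {α b n} → Ack k α b n → size α + b < n
  iter-inflationary : ∀ {α j b n} → Iter k α j b n → j + b ≤ n
  iter-bound        : ∀ {α j b n} → Iter k α (suc j) b n → size α + (j + b) < n
  seq-bound         : ∀ {λ' l b μ} → Seq k λ' (suc l) b μ → size λ' ≤ suc (size μ)

  -- The last application of A_α(k,·) gives the bound; earlier ones only raise b.
  iter-bound (itS it a) = ≤-trans (s≤s (+-monoʳ-≤ _ (iter-inflationary it))) (ack-bound a)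

  iter-inflationary it0 = ≤-refl
  iter-inflationary (itS it a) =
    ≤-trans (s≤s (iter-inflationary it)) (≤-trans (s≤s (m≤n+m _ _)) (ack-bound a))

  -- λ_{l+1,k,b} = λ[c] with c = A_μ(k,b) > 0, so Step 1b applies.
  seq-bound {λ'} (sqS {c = zero} s a) = ⊥-elim (n≮0 (ack-bound a))
  seq-bound {λ'} (sqS {c = suc c} s a) = fund-size λ' c

  iter-k-bound : ∀ {β n} → Iter k β k 0 n → 2 + size β ≤ n
  iter-k-bound {β} it =
    ≤-trans (s≤s (≤-trans (s≤s (m≤m+n (size β) (i + 0))) (≤-reflexive (sym (+-suc _ _)))))
            (iter-bound it)

  -- The cases A_α(k,b+1) = A_β(k,·)^k(A_α(k,b)) only need inflationarity.
  step-bound : ∀ {α β b m n} → size α + b < m → Iter k β k m n → size α + suc b < n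
  step-bound {α} {b = b} {m} lt it =
    ≤-trans (s≤s (≤-trans (≤-reflexive (+-suc (size α) b)) lt))
            (≤-trans (s≤s (m≤n+m m (suc i))) (iter-inflationary it))

  ack-bound ack0 = ≤-refl
  ack-bound {α} (ackS0 eq it) =
    ≤-trans (s≤s (≤-reflexive (trans (+-identityʳ (size α)) (size-succ α eq)))) (iter-k-bound it)
  ack-bound (ackSS eq a it) = step-bound (ack-bound a) it
  ack-bound {α} (ackL0 eq s it) =
    ≤-trans (s≤s (≤-trans (≤-reflexive (+-identityʳ (size α))) (seq-bound s))) (iter-k-bound it)
  ack-bound (ackLS eq a s it) = step-bound (ack-bound a) it

termsUpTo : ℕ → List OT
termsUpTo zero = 𝟎 ∷ []
termsUpTo (suc m) = 𝟎 ∷ cartesianProductWith ω^_+_ (termsUpTo m) (termsUpTo m)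

termsUpTo-complete : ∀ m α → size α ≤ m → α ∈ termsUpTo m
termsUpTo-complete zero 𝟎 _ = here refl
termsUpTo-complete (suc m) 𝟎 _ = here refl
termsUpTo-complete (suc m) (ω^ a + b) (s≤s le) =
  there (∈-cartesianProductWith⁺ ω^_+_
          (termsUpTo-complete m a (≤-trans (m≤m+n (size a) (size b)) le))
          (termsUpTo-complete m b (≤-trans (m≤n+m (size b) (size a)) le)))

-- Main theorem: A_α(k,0) ≤ m implies size α < m, so α is among termsUpTo m.
mainTheorem10 : (k : ℕ) → 3 ≤ k → (m : ℕ) →
    Σ (List OT) (λ L → (α : OT) → IsCNF α → (n : ℕ) → Ack k α 0 n → n ≤ m → α ∈ L)
mainTheorem10 (suc (suc i)) (s≤s (s≤s _)) m = termsUpTo m , small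
  where
  small : (α : OT) → IsCNF α → (n : ℕ) → Ack (2 + i) α 0 n → n ≤ m → α ∈ termsUpTo m
  small α _ n a n≤m =
    termsUpTo-complete m α
      (≤-trans (m≤m+n (size α) 0) (≤-trans (<⇒≤ (Growth.ack-bound i a)) n≤m))
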